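{- Let $G$ be a connected graph with no subgraph isomorphic to $Y$, and let $P=v_0v_1\dots v_\ell$ be a longest path in $G$, chosen subject to that to minimize $\deg(v_0)+\deg(v_\ell)$, with $\ell\ge5$. Let $L_i=N_G(v_i)\setminus V(P)$. Suppose that either $G$ has an edge $v_iv_j$ with $i\in\{0,1\}$ and $j\in\{\ell-1,\ell\}$, or $L_1\cap L_{\ell-1}\neq\emptyset$. Then $G$ has an edge-dominating cycle of length at least $\ell-1$, and hence at least $4$.
   Context: All graphs are finite and simple. $Y$ is the 7-vertex tree obtained from $K_{1,3}$ by subdividing each edge exactly once. A cycle $C$ in $G$ is edge-dominating if every edge of $G$ has at least one endpoint on $C$. -}

module Defs where

open import Data.Nat using (ℕ; zero; suc; _+_; _≤_)
open import Data.Fin using (Fin; zero; suc; fromℕ; inject₁; #_)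
open import Data.Fin.Base using ()
open import Data.Bool using (Bool; true; false; T)
open import Data.List using (length; filterᵇ)
open import Data.List using () renaming (allFin to allFinL)
open import Data.Product using (Σ; ∃; _×_; _,_)
open import Data.Sum using (_⊎_)
open import Relation.Nullary using (¬_)
open import Relation.Binary.PropositionalEquality using (_≡_)
open import Function.Definitions using (Injective)

record Graph : Set where
  field
    n     : ℕ
    adj   : Fin n → Fin n → Bool
    adj-sym  : ∀ u v → adj u v ≡ adj v u
    adj-irr  : ∀ v → adj v v ≡ false

module _ (G : Graph) where
  open Graph G

  V : Set
  V = Fin n

  E : V → V → Set
  E u v = T (adj u v)

  deg : V → ℕ
  deg v = length (filterᵇ (adj v) (allFinL n))

  IsPath : (ℓ : ℕ) → (Fin (suc ℓ) → V) → Set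
  IsPath ℓ P = Injective _≡_ _≡_ P × (∀ (i : Fin ℓ) → E (P (inject₁ i)) (P (suc i)))

  Connected : Set
  Connected = ∀ (u v : V) → Σ ℕ λ ℓ → Σ (Fin (suc ℓ) → V) λ P →
                IsPath ℓ P × P zero ≡ u × P (fromℕ ℓ) ≡ v

  -- G contains a (not necessarily induced) subgraph isomorphic to Y:
  -- Y has centre 0, middle vertices 1,2,3, leaves 4,5,6, edges 0-1,0-2,0-3,1-4,2-5,3-6.
  HasY : Set
  HasY = Σ (Fin 7 → V) λ f → Injective _≡_ _≡_ f ×
           E (f (# 0)) (f (# 1)) × E (f (# 0)) (f (# 2)) × E (f (# 0)) (f (# 3)) ×
           E (f (# 1)) (f (# 4)) × E (f (# 2)) (f (# 5)) × E (f (# 3)) (f (# 6))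

  YFree : Set
  YFree = ¬ HasY

  IsLongestPath : (ℓ : ℕ) → (Fin (suc ℓ) → V) → Set
  IsLongestPath ℓ P = IsPath ℓ P × (∀ (m : ℕ) (Q : Fin (suc m) → V) → IsPath m Q → m ≤ ℓ)

  IsMinLongestPath : (ℓ : ℕ) → (Fin (suc ℓ) → V) → Set
  IsMinLongestPath ℓ P = IsLongestPath ℓ P ×
    (∀ (Q : Fin (suc ℓ) → V) → IsLongestPath ℓ Q →
       deg (P zero) + deg (P (fromℕ ℓ)) ≤ deg (Q zero) + deg (Q (fromℕ ℓ)))

  -- C = C 0, ..., C k is a cycle of length suc k (needs suc k ≥ 3)
  IsCycle : (k : ℕ) → (Fin (suc k) → V) → Set
  IsCycle k C = 3 ≤ suc k × Injective _≡_ _≡_ C ×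
                (∀ (i : Fin k) → E (C (inject₁ i)) (C (suc i))) × E (C (fromℕ k)) (C zero)

  EdgeDominating : (k : ℕ) → (Fin (suc k) → V) → Set
  EdgeDominating k C = ∀ (u v : V) → E u v → (∃ λ i → C i ≡ u) ⊎ (∃ λ i → C i ≡ v)

-- index 1 in Fin (suc ℓ) (meaningful for ℓ ≥ 1)
idx1 : (ℓ : ℕ) → Fin (suc ℓ)
idx1 zero = zero
idx1 (suc ℓ) = suc zero

-- index ℓ - 1 in Fin (suc ℓ) (meaningful for ℓ ≥ 1)
idxPen : (ℓ : ℕ) → Fin (suc ℓ)
idxPen zero = zero
idxPen (suc ℓ) = inject₁ (fromℕ ℓ)

-- Read the path as a₀ a₁ … aₚ aₗ.  Each hypothesis closes a cycle: the edge a₀aₗ closes all of P; the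
-- edges a₀aₚ, a₁aₗ or a common neighbour of a₁ and aₚ off P close a cycle on ℓ vertices; the chord a₁aₚ
-- closes C = a₁ … aₚ on ℓ − 1 vertices.  In a connected graph a cycle is edge-dominating unless a path
-- c z w hangs off it (c on the cycle, z and w off it).  For a cycle on at least ℓ vertices, such a path
-- followed by the cycle opened at c is longer than P.  For C (when a₀aₗ is not an edge), z and w also
-- avoid a₀ and aₗ, all of whose neighbours lie on P; using the chord a₁aₚ, c is an interior vertex of
-- a path on V(P) with two vertices on either side of it, which together with c z w form a Y.
module Submission where

open import Defs
open import Algebra.Solver.CommutativeMonoid as CommutativeMonoidSolver using ()
open import Data.Bool using (T)
open import Data.Empty using (⊥; ⊥-elim)
open import Data.Fin using (Fin; zero; suc; fromℕ; inject₁; _≟_)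
open import Data.List using (List; []; _∷_; [_]; _++_; _∷ʳ_; length; lookup; tabulate; initLast; _∷ʳ′_)
open import Data.List.Properties using (++-assoc; length-tabulate)
open import Data.List.Membership.Propositional using (_∈_; _∉_; lose)
open import Data.List.Membership.Propositional.Properties
  using (∈-∃++; ∈-++⁻; ∈-++⁺ˡ; ∈-lookup; ∈-tabulate⁺; ∈-tabulate⁻)
open import Data.List.Relation.Binary.Permutation.Propositional using (_↭_; ↭-refl; ↭-sym; ↭⇒↭ₛ)
open import Data.List.Relation.Binary.Permutation.Propositional.Properties
  using (++-comm; ↭-length; ∈-resp-↭; ++-commutativeMonoid)
open import Data.List.Relation.Binary.Permutation.Setoid.Properties as ↭ₛ using ()
open import Data.List.Relation.Unary.All as All using (_∷_)
open import Data.List.Relation.Unary.All.Properties as All using ()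
open import Data.List.Relation.Unary.AllPairs using ([]; _∷_)
open import Data.List.Relation.Unary.Any using (Any; here; there; index)
open import Data.List.Relation.Unary.Any.Properties using (lookup-index)
open import Data.List.Relation.Unary.Linked as Linked using (Linked; []; [-]; _∷_)
open import Data.List.Relation.Unary.Unique.Propositional using (Unique)
open import Data.List.Relation.Unary.Unique.Propositional.Properties using (tabulate⁺)
open import Data.Nat using (ℕ; zero; suc; _+_; _∸_; _≤_; s≤s; z≤n)
open import Data.Nat.Properties using (≤-trans; ≤-reflexive; n≤1+n; 1+n≰n)
open import Data.Product as Product using (Σ; ∃; _×_; _,_; proj₁; proj₂)
open import Data.Sum as Sum using (_⊎_; inj₁; inj₂)
open import Function using (_∘_)
open import Function.Definitions using (Injective)
open import Relation.Nullary using (¬_; Dec; yes; no)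
open import Relation.Nullary.Decidable using (T?)
open import Relation.Binary.PropositionalEquality
  using (_≡_; _≢_; refl; sym; trans; cong; subst; subst₂; setoid)

module _ {A : Set} where

  Unique-resp-↭ : {xs ys : List A} → xs ↭ ys → Unique xs → Unique ys
  Unique-resp-↭ σ = ↭ₛ.Unique-resp-↭ (setoid A) (↭⇒↭ₛ σ)

  Unique-∷ : ∀ {x} {xs : List A} → x ∉ xs → Unique xs → Unique (x ∷ xs)
  Unique-∷ {xs = xs} x∉ u = All.¬Any⇒All¬ xs x∉ ∷ u

  Unique-∷ʳ : ∀ {x} {xs : List A} → x ∉ xs → Unique xs → Unique (xs ∷ʳ x)
  Unique-∷ʳ {x} {xs} x∉ u = Unique-resp-↭ (++-comm [ x ] xs) (Unique-∷ x∉ u)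

  Unique-++⁻ˡ : ∀ xs {ys : List A} → Unique (xs ++ ys) → Unique xs
  Unique-++⁻ˡ []       _          = []
  Unique-++⁻ˡ (x ∷ xs) (x∉ ∷ u) = All.++⁻ˡ xs x∉ ∷ Unique-++⁻ˡ xs u

  lookup-injective : ∀ {xs : List A} → Unique xs → Injective _≡_ _≡_ (lookup xs)
  lookup-injective {x ∷ xs} _        {zero}  {zero}  _  = refl
  lookup-injective {x ∷ xs} (x∉ ∷ _) {zero}  {suc j} eq = ⊥-elim (All.lookup x∉ (∈-lookup j) eq)
  lookup-injective {x ∷ xs} (x∉ ∷ _) {suc i} {zero}  eq = ⊥-elim (All.lookup x∉ (∈-lookup i) (sym eq))
  lookup-injective {x ∷ xs} (_ ∷ u)  {suc i} {suc j} eq = cong suc (lookup-injective u eq)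

  ∈⇒lookup : ∀ {x} {xs : List A} → x ∈ xs → ∃ λ i → lookup xs i ≡ x
  ∈⇒lookup x∈ = index x∈ , sym (lookup-index x∈)

  length-∷ʳ : ∀ (xs : List A) x → length (xs ∷ʳ x) ≡ suc (length xs)
  length-∷ʳ xs x = ↭-length (++-comm xs [ x ])

  tabulate-∷ʳ : ∀ {m} (f : Fin (suc m) → A) → tabulate f ≡ tabulate (f ∘ inject₁) ∷ʳ f (fromℕ m)
  tabulate-∷ʳ {zero} f = refl
  tabulate-∷ʳ {suc m}  f = cong (f zero ∷_) (tabulate-∷ʳ (f ∘ suc))

module _ {A : Set} {R : A → A → Set} where

  Linked-++⁻ˡ : ∀ xs {ys} → Linked R (xs ++ ys) → Linked R xs
  Linked-++⁻ˡ []           _       = []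
  Linked-++⁻ˡ (x ∷ [])     _       = [-]
  Linked-++⁻ˡ (x ∷ y ∷ xs) (r ∷ l) = r ∷ Linked-++⁻ˡ (y ∷ xs) l

  Linked-split : ∀ xs {y ys} → Linked R (xs ++ y ∷ ys) → Linked R (xs ∷ʳ y) × Linked R (y ∷ ys)
  Linked-split []            l       = [-] , l
  Linked-split (x ∷ [])      (r ∷ l) = r ∷ [-] , l
  Linked-split (x ∷ x′ ∷ xs) (r ∷ l) = Product.map₁ (r ∷_) (Linked-split (x′ ∷ xs) l)

  Linked-join : ∀ xs {y ys} → Linked R (xs ∷ʳ y) → Linked R (y ∷ ys) → Linked R (xs ++ y ∷ ys)
  Linked-join []            _        l = l
  Linked-join (x ∷ [])      (r ∷ _)  l = r ∷ l
  Linked-join (x ∷ x′ ∷ xs) (r ∷ l′) l = r ∷ Linked-join (x′ ∷ xs) l′ l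

  Linked-∷ʳ : ∀ xs {y z} → Linked R (xs ∷ʳ y) → R y z → Linked R (xs ∷ʳ y ∷ʳ z)
  Linked-∷ʳ []            [-]      r = r ∷ [-]
  Linked-∷ʳ (x ∷ [])      (r′ ∷ l) r = r′ ∷ Linked-∷ʳ [] l r
  Linked-∷ʳ (x ∷ x′ ∷ xs) (r′ ∷ l) r = r′ ∷ Linked-∷ʳ (x′ ∷ xs) l r

  Linked-∷ʳ⁻ : ∀ xs {y z} → Linked R (xs ∷ʳ y ∷ʳ z) → Linked R (xs ∷ʳ y) × R y z
  Linked-∷ʳ⁻ []            (r ∷ [-]) = [-] , r
  Linked-∷ʳ⁻ (x ∷ [])      (r ∷ l)   = Product.map₁ (r ∷_) (Linked-∷ʳ⁻ [] l)
  Linked-∷ʳ⁻ (x ∷ x′ ∷ xs) (r ∷ l)   = Product.map₁ (r ∷_) (Linked-∷ʳ⁻ (x′ ∷ xs) l)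

  Linked-tabulate : ∀ {m} {f : Fin (suc m) → A} →
    (∀ i → R (f (inject₁ i)) (f (suc i))) → Linked R (tabulate f)
  Linked-tabulate {zero} _ = [-]
  Linked-tabulate {suc m} {f} r = r zero ∷ Linked-tabulate {f = f ∘ suc} (r ∘ suc)

  Linked-lookup : ∀ {x xs} → Linked R (x ∷ xs) →
    ∀ i → R (lookup (x ∷ xs) (inject₁ i)) (lookup (x ∷ xs) (suc i))
  Linked-lookup (r ∷ _) zero    = r
  Linked-lookup (_ ∷ l) (suc i) = Linked-lookup l i

  Linked-lookup-∷ʳ : ∀ {x xs y} → Linked R (x ∷ xs ∷ʳ y) → R (lookup (x ∷ xs) (fromℕ (length xs))) y
  Linked-lookup-∷ʳ {xs = []}     (r ∷ [-]) = r
  Linked-lookup-∷ʳ {xs = _ ∷ xs} (_ ∷ l)   = Linked-lookup-∷ʳ {xs = xs} l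

module Paths (G : Graph) where
  open Graph G using (n; adj; adj-sym; adj-irr)
  open import Data.List.Membership.DecPropositional (_≟_ {n}) using (_∈?_)

  infix 4 _~_
  _~_ : V G → V G → Set
  _~_ = E G

  _~?_ : ∀ u v → Dec (u ~ v)
  u ~? v = T? (adj u v)

  ~-sym : ∀ {u v} → u ~ v → v ~ u
  ~-sym {u} {v} = subst T (adj-sym u v)

  ~⇒≢ : ∀ {u v} → u ~ v → u ≢ v
  ~⇒≢ {u} u~u refl = subst T (adj-irr u) u~u

  SimplePath : List (V G) → Set
  SimplePath xs = Unique xs × Linked _~_ xs

  SimplePath-++⁻ˡ : ∀ xs {ys} → SimplePath (xs ++ ys) → SimplePath xs
  SimplePath-++⁻ˡ xs (u , l) = Unique-++⁻ˡ xs u , Linked-++⁻ˡ xs l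

  SimplePath-tail : ∀ {x xs} → SimplePath (x ∷ xs) → SimplePath xs
  SimplePath-tail (_ ∷ u , l) = u , Linked.tail l

  ∷-SimplePath : ∀ {x y ys} → x ~ y → x ∉ y ∷ ys → SimplePath (y ∷ ys) → SimplePath (x ∷ y ∷ ys)
  ∷-SimplePath x~y x∉ (u , l) = Unique-∷ x∉ u , x~y ∷ l

  ∷ʳ-SimplePath : ∀ {xs y x} → y ~ x → x ∉ xs ∷ʳ y → SimplePath (xs ∷ʳ y) → SimplePath (xs ∷ʳ y ∷ʳ x)
  ∷ʳ-SimplePath {xs} y~x x∉ (u , l) = Unique-∷ʳ x∉ u , Linked-∷ʳ xs l y~x

  IsPath⇒SimplePath : ∀ {ℓ P} → IsPath G ℓ P → SimplePath (tabulate P)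
  IsPath⇒SimplePath {P = P} (injective , edges) = tabulate⁺ injective , Linked-tabulate {f = P} edges

  Cycle : V G → List (V G) → Set
  Cycle c cs = Unique (c ∷ cs) × Linked _~_ (c ∷ cs ∷ʳ c)

  closing-edge⇒Cycle : ∀ {x} xs {y} → SimplePath (x ∷ xs ∷ʳ y) → y ~ x → Cycle x (xs ∷ʳ y)
  closing-edge⇒Cycle {x} xs (u , l) y~x = u , Linked-∷ʳ (x ∷ xs) l y~x

  Cycle⇒IsCycle : ∀ {c cs} → Cycle c cs → 2 ≤ length cs → IsCycle G (length cs) (lookup (c ∷ cs))
  Cycle⇒IsCycle {c} {cs} (u , l) 2≤ =
    s≤s 2≤ , lookup-injective u , Linked-lookup (Linked-++⁻ˡ (c ∷ cs) l) , Linked-lookup-∷ʳ l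

  Cycle⇒SimplePath-from : ∀ {c cs d} → Cycle c cs → d ∈ c ∷ cs →
    ∃ λ ds → SimplePath (d ∷ ds) × d ∷ ds ↭ c ∷ cs
  Cycle⇒SimplePath-from {c} {cs} (u , l) (here refl) = cs , (u , Linked-++⁻ˡ (c ∷ cs) l) , ↭-refl
  Cycle⇒SimplePath-from {c} {d = d} (u , l) (there d∈) with ∈-∃++ d∈
  ... | p , q , refl =
    q ++ c ∷ p ,
    (Unique-resp-↭ σ u , Linked-join (d ∷ q) (proj₂ halves) (Linked-++⁻ˡ (c ∷ p) (proj₁ halves))) ,
    ↭-sym σ
    where
    σ : c ∷ p ++ d ∷ q ↭ d ∷ q ++ c ∷ p
    σ = ++-comm (c ∷ p) (d ∷ q)
    halves : Linked _~_ (c ∷ p ∷ʳ d) × Linked _~_ (d ∷ q ∷ʳ c)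
    halves = Linked-split (c ∷ p) (subst (Linked _~_) (cong (c ∷_) (++-assoc p (d ∷ q) [ c ])) l)

  data HangingP₂ (C : List (V G)) : Set where
    hanging : ∀ {c z w} → c ∈ C → z ∉ C → w ∉ C → c ~ z → z ~ w → HangingP₂ C

  -- The edge u ~ v and the first vertex of the walk inside C give a hanging P₂.
  walk-into⇒HangingP₂ : ∀ {C v u ws} → v ∉ C → u ∉ C → v ~ u →
    Linked _~_ (u ∷ ws) → Any (_∈ C) ws → HangingP₂ C
  walk-into⇒HangingP₂ {C} {ws = y ∷ _} v∉ u∉ v~u (u~y ∷ l) y⋯∈C with y ∈? C | y⋯∈C
  ... | yes y∈ | _        = hanging y∈ u∉ v∉ (~-sym u~y) (~-sym v~u)
  ... | no y∉  | here y∈  = ⊥-elim (y∉ y∈)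
  ... | no y∉  | there ⋯∈ = walk-into⇒HangingP₂ u∉ y∉ u~y l ⋯∈

  ¬HangingP₂⇒dominating : Connected G → ∀ {C c} → c ∈ C → ¬ HangingP₂ C →
    ∀ {u v} → u ~ v → u ∈ C ⊎ v ∈ C
  ¬HangingP₂⇒dominating conn {C} {c} c∈ ¬hanging {u} {v} u~v with u ∈? C | v ∈? C
  ... | yes u∈ | _      = inj₁ u∈
  ... | no _   | yes v∈ = inj₂ v∈
  ... | no u∉  | no v∉  with conn u c
  ...   | m , Q , (_ , edges) , refl , refl =
    ⊥-elim (¬hanging (walk-into⇒HangingP₂ v∉ u∉ (~-sym u~v) (Linked-tabulate {f = Q} edges) c-on-walk))
    where
    c-on-walk : Any (_∈ C) (tabulate (Q ∘ suc))
    c-on-walk with ∈-tabulate⁺ {f = Q} (fromℕ m)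
    ... | here c≡u = ⊥-elim (u∉ (subst (_∈ C) c≡u c∈))
    ... | there c∈walk = lose c∈walk c∈

  ¬HangingP₂⇒EdgeDominating : Connected G → ∀ {c cs} → ¬ HangingP₂ (c ∷ cs) →
    EdgeDominating G (length cs) (lookup (c ∷ cs))
  ¬HangingP₂⇒EdgeDominating conn ¬hanging u v u~v =
    Sum.map ∈⇒lookup ∈⇒lookup (¬HangingP₂⇒dominating conn (here refl) ¬hanging u~v)

  MaxPathLength : ℕ → Set
  MaxPathLength ℓ = ∀ {xs} → SimplePath xs → length xs ≤ suc ℓ

  IsLongestPath⇒MaxPathLength : ∀ {ℓ P} → IsLongestPath G ℓ P → MaxPathLength ℓ
  IsLongestPath⇒MaxPathLength _             {[]}     _       = z≤n
  IsLongestPath⇒MaxPathLength (_ , longest) {x ∷ xs} (u , l) =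
    s≤s (longest (length xs) (lookup (x ∷ xs)) (lookup-injective u , Linked-lookup l))

  first-neighbour∈path : ∀ {ℓ x xs} → MaxPathLength ℓ → SimplePath (x ∷ xs) → ℓ ≤ length xs →
    ∀ {u} → x ~ u → u ∈ x ∷ xs
  first-neighbour∈path {x = x} {xs} max path long {u} x~u with u ∈? x ∷ xs
  ... | yes u∈ = u∈
  ... | no u∉  = ⊥-elim (1+n≰n (≤-trans (s≤s (s≤s long)) (max (∷-SimplePath (~-sym x~u) u∉ path))))

  last-neighbour∈path : ∀ {ℓ xs x} → MaxPathLength ℓ → SimplePath (xs ∷ʳ x) → ℓ ≤ length xs →
    ∀ {u} → x ~ u → u ∈ xs ∷ʳ x
  last-neighbour∈path {xs = xs} {x} max path long {u} x~u with u ∈? xs ∷ʳ x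
  ... | yes u∈ = u∈
  ... | no u∉  =
    ⊥-elim (1+n≰n (≤-trans (s≤s (s≤s long)) (subst (_≤ _) |xs∷ʳx∷ʳu| (max (∷ʳ-SimplePath x~u u∉ path)))))
    where
    |xs∷ʳx∷ʳu| : length (xs ∷ʳ x ∷ʳ u) ≡ suc (suc (length xs))
    |xs∷ʳx∷ʳu| = trans (length-∷ʳ (xs ∷ʳ x) u) (cong suc (length-∷ʳ xs x))

  long-Cycle⇒¬HangingP₂ : ∀ {ℓ c cs} → MaxPathLength ℓ → Cycle c cs → ℓ ≤ suc (length cs) →
    ¬ HangingP₂ (c ∷ cs)
  long-Cycle⇒¬HangingP₂ {ℓ} {c} {cs} max cycle long (hanging {d} {z} {w} d∈ z∉ w∉ d~z z~w)
    with Cycle⇒SimplePath-from cycle d∈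
  ... | ds , path , σ =
    1+n≰n (≤-trans (s≤s (s≤s long′)) (max (∷-SimplePath (~-sym z~w) w∉′ (∷-SimplePath (~-sym d~z) z∉′ path))))
    where
    long′ : ℓ ≤ suc (length ds)
    long′ = subst (ℓ ≤_) (sym (↭-length σ)) long
    z∉′ : z ∉ d ∷ ds
    z∉′ = z∉ ∘ ∈-resp-↭ σ
    w∉′ : w ∉ z ∷ d ∷ ds
    w∉′ (here w≡z)  = ~⇒≢ z~w (sym w≡z)
    w∉′ (there w∈) = w∉ (∈-resp-↭ σ w∈)

  HasY-intro : ∀ {c x₁ x₂ x₃ y₁ y₂ y₃} → Unique (c ∷ x₁ ∷ x₂ ∷ x₃ ∷ y₁ ∷ y₂ ∷ y₃ ∷ []) →
    c ~ x₁ → c ~ x₂ → c ~ x₃ → x₁ ~ y₁ → x₂ ~ y₂ → x₃ ~ y₃ → HasY G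
  HasY-intro {c} {x₁} {x₂} {x₃} {y₁} {y₂} {y₃} u e₁ e₂ e₃ e₄ e₅ e₆ =
    lookup (c ∷ x₁ ∷ x₂ ∷ x₃ ∷ y₁ ∷ y₂ ∷ y₃ ∷ []) , lookup-injective u , e₁ , e₂ , e₃ , e₄ , e₅ , e₆

  open CommutativeMonoidSolver (++-commutativeMonoid {A = V G}) using (solve; _⊜_; _⊕_)

  interior-HasY : ∀ xs ys {c z w} → 2 ≤ length xs → 2 ≤ length ys →
    Unique (z ∷ w ∷ xs ++ c ∷ ys) → Linked _~_ (xs ++ c ∷ ys) → c ~ z → z ~ w → HasY G
  interior-HasY xs [] _ () _ _ _ _
  interior-HasY xs (_ ∷ []) _ (s≤s ()) _ _ _ _
  interior-HasY xs (r₁ ∷ r₂ ∷ post) {c} {z} {w} 2≤xs _ u l c~z z~w with initLast xs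
  ... | [] with () ← 2≤xs
  ... | pre ∷ʳ′ l₁ with initLast pre
  ...   | [] with s≤s () ← 2≤xs
  ...   | pre′ ∷ʳ′ l₂ with Linked-split (pre′ ∷ʳ l₂ ∷ʳ l₁) l
  ...     | ⋯l₁c , c~r₁ ∷ r₁~r₂ ∷ _ =
    HasY-intro (Unique-++⁻ˡ (c ∷ l₁ ∷ r₁ ∷ z ∷ l₂ ∷ r₂ ∷ w ∷ []) (Unique-resp-↭ σ u))
      (~-sym l₁~c) c~r₁ c~z (~-sym l₂~l₁) r₁~r₂ z~w
    where
    l₁~c : l₁ ~ c
    l₁~c = proj₂ (Linked-∷ʳ⁻ (pre′ ∷ʳ l₂) ⋯l₁c)
    l₂~l₁ : l₂ ~ l₁
    l₂~l₁ = proj₂ (Linked-∷ʳ⁻ pre′ (proj₁ (Linked-∷ʳ⁻ (pre′ ∷ʳ l₂) ⋯l₁c)))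
    σ : z ∷ w ∷ (pre′ ∷ʳ l₂ ∷ʳ l₁) ++ c ∷ r₁ ∷ r₂ ∷ post ↭
        (c ∷ l₁ ∷ r₁ ∷ z ∷ l₂ ∷ r₂ ∷ w ∷ []) ++ pre′ ++ post
    σ = solve 9 (λ Z W P L₂ L₁ C R₁ R₂ Q →
                   Z ⊕ W ⊕ ((P ⊕ L₂) ⊕ L₁) ⊕ C ⊕ R₁ ⊕ R₂ ⊕ Q ⊜ (C ⊕ L₁ ⊕ R₁ ⊕ Z ⊕ L₂ ⊕ R₂ ⊕ W) ⊕ P ⊕ Q)
          ↭-refl [ z ] [ w ] pre′ [ l₂ ] [ l₁ ] [ c ] [ r₁ ] [ r₂ ] post

  chord-HasY : ∀ {a₀ a₁ aₚ aₗ ms c z w} → 2 ≤ length ms → SimplePath (a₀ ∷ a₁ ∷ ms ∷ʳ aₚ ∷ʳ aₗ) →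
    a₁ ~ aₚ → Unique (z ∷ w ∷ a₀ ∷ a₁ ∷ ms ∷ʳ aₚ ∷ʳ aₗ) → c ∈ a₁ ∷ ms ∷ʳ aₚ → c ~ z → z ~ w → HasY G
  chord-HasY {a₀} {a₁} {aₚ} {aₗ} {ms} {z = z} {w} 2≤ms (_ , a₀⋯aₗ) a₁~aₚ u c∈ c~z z~w = at c∈ c~z
    where
    a₀⋯aₚ : Linked _~_ (a₀ ∷ a₁ ∷ ms ∷ʳ aₚ)
    a₀⋯aₚ = proj₁ (Linked-∷ʳ⁻ (a₀ ∷ a₁ ∷ ms) a₀⋯aₗ)
    aₚ~aₗ : aₚ ~ aₗ
    aₚ~aₗ = proj₂ (Linked-∷ʳ⁻ (a₀ ∷ a₁ ∷ ms) a₀⋯aₗ)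
    a₀⋯m : Linked _~_ (a₀ ∷ a₁ ∷ ms)
    a₀⋯m = Linked-++⁻ˡ (a₀ ∷ a₁ ∷ ms) a₀⋯aₚ

    -- The chord a₁ aₚ reroutes the path so that a₁, resp. aₚ, becomes an interior vertex.
    σ₁ : z ∷ w ∷ a₀ ∷ a₁ ∷ ms ∷ʳ aₚ ∷ʳ aₗ ↭ (z ∷ w ∷ aₗ ∷ aₚ ∷ a₁ ∷ ms) ++ [ a₀ ]
    σ₁ = solve 7 (λ Z W A₀ A₁ M Aₚ Aₗ → Z ⊕ W ⊕ A₀ ⊕ A₁ ⊕ (M ⊕ Aₚ) ⊕ Aₗ ⊜ (Z ⊕ W ⊕ Aₗ ⊕ Aₚ ⊕ A₁ ⊕ M) ⊕ A₀)
           ↭-refl [ z ] [ w ] [ a₀ ] [ a₁ ] ms [ aₚ ] [ aₗ ]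
    σ₂ : z ∷ w ∷ a₀ ∷ a₁ ∷ ms ∷ʳ aₚ ∷ʳ aₗ ↭ (z ∷ w ∷ ms ++ aₚ ∷ a₁ ∷ a₀ ∷ []) ++ [ aₗ ]
    σ₂ = solve 7 (λ Z W A₀ A₁ M Aₚ Aₗ → Z ⊕ W ⊕ A₀ ⊕ A₁ ⊕ (M ⊕ Aₚ) ⊕ Aₗ ⊜ (Z ⊕ W ⊕ M ⊕ Aₚ ⊕ A₁ ⊕ A₀) ⊕ Aₗ)
           ↭-refl [ z ] [ w ] [ a₀ ] [ a₁ ] ms [ aₚ ] [ aₗ ]

    at : ∀ {c} → c ∈ a₁ ∷ ms ∷ʳ aₚ → c ~ z → HasY G
    at (here refl) c~z =
      interior-HasY (aₗ ∷ aₚ ∷ []) ms (s≤s (s≤s z≤n)) 2≤ms (Unique-++⁻ˡ _ (Unique-resp-↭ σ₁ u))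
        (~-sym aₚ~aₗ ∷ ~-sym a₁~aₚ ∷ Linked.tail a₀⋯m) c~z z~w
    at (there c∈) c~z with ∈-++⁻ ms c∈
    ... | inj₂ (here refl) =
      interior-HasY ms (a₁ ∷ a₀ ∷ []) 2≤ms (s≤s (s≤s z≤n)) (Unique-++⁻ˡ _ (Unique-resp-↭ σ₂ u))
        (Linked-join ms (Linked.tail (Linked.tail a₀⋯aₚ)) (~-sym a₁~aₚ ∷ ~-sym (Linked.head a₀⋯m) ∷ [-]))
        c~z z~w
    ... | inj₁ c∈ms with ∈-∃++ c∈ms
    ...   | p , q , ms≡p⋯q =
      interior-HasY (a₀ ∷ a₁ ∷ p) (q ∷ʳ aₚ ∷ʳ aₗ) (s≤s (s≤s z≤n)) 2≤q⋯aₗ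
        (subst (λ t → Unique (z ∷ w ∷ a₀ ∷ a₁ ∷ t)) split u)
        (subst (λ t → Linked _~_ (a₀ ∷ a₁ ∷ t)) split a₀⋯aₗ)
        c~z z~w
      where
      split : ms ∷ʳ aₚ ∷ʳ aₗ ≡ p ++ _ ∷ q ∷ʳ aₚ ∷ʳ aₗ
      split = trans (cong (λ t → t ∷ʳ aₚ ∷ʳ aₗ) ms≡p⋯q)
                (trans (cong (_∷ʳ aₗ) (++-assoc p (_ ∷ q) [ aₚ ])) (++-assoc p (_ ∷ q ∷ʳ aₚ) [ aₗ ]))
      2≤q⋯aₗ : 2 ≤ length (q ∷ʳ aₚ ∷ʳ aₗ)
      2≤q⋯aₗ =
        subst (2 ≤_) (sym (trans (length-∷ʳ (q ∷ʳ aₚ) aₗ) (cong suc (length-∷ʳ q aₚ)))) (s≤s (s≤s z≤n))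

  ∉inner⇒end : ∀ {a b : V G} C {u} → u ∈ a ∷ C ∷ʳ b → u ∉ C → u ≡ a ⊎ u ≡ b
  ∉inner⇒end C (here u≡a) _  = inj₁ u≡a
  ∉inner⇒end C (there u∈) u∉ with ∈-++⁻ C u∈
  ... | inj₁ u∈C        = ⊥-elim (u∉ u∈C)
  ... | inj₂ (here u≡b) = inj₂ u≡b

  off-inner⇒off-path : ∀ {a b C z w} → ¬ a ~ b →
    (∀ {u} → a ~ u → u ∈ a ∷ C ∷ʳ b) → (∀ {u} → b ~ u → u ∈ a ∷ C ∷ʳ b) →
    z ∉ C → w ∉ C → z ~ w → z ∉ a ∷ C ∷ʳ b
  off-inner⇒off-path {a} {b} {C} {z} {w} ¬a~b a-closed b-closed z∉ w∉ z~w z∈ =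
    both-ends (∉inner⇒end C z∈ z∉) (∉inner⇒end C (neighbour-on-path (∉inner⇒end C z∈ z∉)) w∉)
    where
    neighbour-on-path : z ≡ a ⊎ z ≡ b → w ∈ a ∷ C ∷ʳ b
    neighbour-on-path (inj₁ z≡a) = a-closed (subst (_~ w) z≡a z~w)
    neighbour-on-path (inj₂ z≡b) = b-closed (subst (_~ w) z≡b z~w)
    both-ends : z ≡ a ⊎ z ≡ b → w ≡ a ⊎ w ≡ b → ⊥
    both-ends (inj₁ z≡a) (inj₁ w≡a) = ~⇒≢ z~w (trans z≡a (sym w≡a))
    both-ends (inj₁ z≡a) (inj₂ w≡b) = ¬a~b (subst₂ _~_ z≡a w≡b z~w)
    both-ends (inj₂ z≡b) (inj₁ w≡a) = ¬a~b (subst₂ _~_ w≡a z≡b (~-sym z~w))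
    both-ends (inj₂ z≡b) (inj₂ w≡b) = ~⇒≢ z~w (trans z≡b (sym w≡b))

  chorded-Cycle⇒¬HangingP₂ : ∀ {a₀ a₁ aₚ aₗ ms} → YFree G → 2 ≤ length ms →
    SimplePath (a₀ ∷ a₁ ∷ ms ∷ʳ aₚ ∷ʳ aₗ) → a₁ ~ aₚ → ¬ a₀ ~ aₗ →
    (∀ {u} → a₀ ~ u → u ∈ a₀ ∷ a₁ ∷ ms ∷ʳ aₚ ∷ʳ aₗ) → (∀ {u} → aₗ ~ u → u ∈ a₀ ∷ a₁ ∷ ms ∷ʳ aₚ ∷ʳ aₗ) →
    ¬ HangingP₂ (a₁ ∷ ms ∷ʳ aₚ)
  chorded-Cycle⇒¬HangingP₂ {a₀} {a₁} {aₚ} {aₗ} {ms} yfree 2≤ms path a₁~aₚ ¬a₀~aₗ a₀-closed aₗ-closed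
    (hanging {z = z} {w} c∈ z∉ w∉ c~z z~w) =
    yfree (chord-HasY 2≤ms path a₁~aₚ (Unique-∷ z∉w⋯ (Unique-∷ w∉path (proj₁ path))) c∈ c~z z~w)
    where
    z∉path : z ∉ a₀ ∷ a₁ ∷ ms ∷ʳ aₚ ∷ʳ aₗ
    z∉path = off-inner⇒off-path ¬a₀~aₗ a₀-closed aₗ-closed z∉ w∉ z~w
    w∉path : w ∉ a₀ ∷ a₁ ∷ ms ∷ʳ aₚ ∷ʳ aₗ
    w∉path = off-inner⇒off-path ¬a₀~aₗ a₀-closed aₗ-closed w∉ z∉ (~-sym z~w)
    z∉w⋯ : z ∉ w ∷ a₀ ∷ a₁ ∷ ms ∷ʳ aₚ ∷ʳ aₗ
    z∉w⋯ (here z≡w) = ~⇒≢ z~w z≡w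
    z∉w⋯ (there z∈) = z∉path z∈

  CycleWithoutHangingP₂ : ℕ → Set
  CycleWithoutHangingP₂ m =
    Σ (V G) λ c → Σ (List (V G)) λ cs → Cycle c cs × ¬ HangingP₂ (c ∷ cs) × m ≤ length cs

  edge-dominating-cycle : Connected G → ∀ {m} → CycleWithoutHangingP₂ (2 + m) →
    Σ ℕ λ k → Σ (Fin (suc k) → V G) λ C → IsCycle G k C × EdgeDominating G k C × 3 + m ≤ suc k
  edge-dominating-cycle conn (c , cs , cycle , ¬hanging , long) =
    length cs , lookup (c ∷ cs) , Cycle⇒IsCycle cycle (≤-trans (s≤s (s≤s z≤n)) long) ,
    ¬HangingP₂⇒EdgeDominating conn ¬hanging , s≤s long

  long-path⇒CycleWithoutHangingP₂ : YFree G → ∀ {k a₀ a₁ aₚ aₗ ms} → length ms ≡ 2 + k →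
    MaxPathLength (5 + k) → SimplePath (a₀ ∷ a₁ ∷ ms ∷ʳ aₚ ∷ʳ aₗ) →
    (a₀ ~ aₚ ⊎ a₀ ~ aₗ ⊎ a₁ ~ aₚ ⊎ a₁ ~ aₗ) ⊎
      (Σ (V G) λ x → a₁ ~ x × aₚ ~ x × x ∉ a₀ ∷ a₁ ∷ ms ∷ʳ aₚ ∷ʳ aₗ) →
    CycleWithoutHangingP₂ (3 + k)
  long-path⇒CycleWithoutHangingP₂ yfree {k} {a₀} {a₁} {aₚ} {aₗ} {ms} length-ms max a₀⋯aₗ = cases
    where
    length-ms∷ʳ : ∀ y → length (ms ∷ʳ y) ≡ 3 + k
    length-ms∷ʳ y = trans (length-∷ʳ ms y) (cong suc length-ms)
    length-ms∷ʳ∷ʳ : ∀ y y′ → length (ms ∷ʳ y ∷ʳ y′) ≡ 4 + k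
    length-ms∷ʳ∷ʳ y y′ = trans (length-∷ʳ (ms ∷ʳ y) y′) (cong suc (length-ms∷ʳ y))
    a₀⋯aₚ : SimplePath (a₀ ∷ a₁ ∷ ms ∷ʳ aₚ)
    a₀⋯aₚ = SimplePath-++⁻ˡ (a₀ ∷ a₁ ∷ ms ∷ʳ aₚ) a₀⋯aₗ

    long : ∀ {c cs} → Cycle c cs → 4 + k ≤ length cs → CycleWithoutHangingP₂ (3 + k)
    long {c} {cs} cycle len =
      c , cs , cycle , long-Cycle⇒¬HangingP₂ max cycle (s≤s len) , ≤-trans (n≤1+n _) len

    whole-path : a₀ ~ aₗ → CycleWithoutHangingP₂ (3 + k)
    whole-path a₀~aₗ = long (closing-edge⇒Cycle (a₁ ∷ ms ∷ʳ aₚ) a₀⋯aₗ (~-sym a₀~aₗ))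
      (≤-trans (n≤1+n _) (≤-reflexive (sym (cong suc (length-ms∷ʳ∷ʳ aₚ aₗ)))))

    chorded : a₁ ~ aₚ → ¬ a₀ ~ aₗ → CycleWithoutHangingP₂ (3 + k)
    chorded a₁~aₚ ¬a₀~aₗ =
      a₁ , ms ∷ʳ aₚ , closing-edge⇒Cycle ms (SimplePath-tail a₀⋯aₚ) (~-sym a₁~aₚ) ,
      chorded-Cycle⇒¬HangingP₂ yfree (subst (2 ≤_) (sym length-ms) (s≤s (s≤s z≤n))) a₀⋯aₗ a₁~aₚ ¬a₀~aₗ
        (first-neighbour∈path max a₀⋯aₗ (≤-reflexive (sym (cong suc (length-ms∷ʳ∷ʳ aₚ aₗ)))))
        (last-neighbour∈path {xs = a₀ ∷ a₁ ∷ ms ∷ʳ aₚ} max a₀⋯aₗ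
          (≤-reflexive (sym (cong (2 +_) (length-ms∷ʳ aₚ))))) ,
      ≤-reflexive (sym (length-ms∷ʳ aₚ))

    cases : (a₀ ~ aₚ ⊎ a₀ ~ aₗ ⊎ a₁ ~ aₚ ⊎ a₁ ~ aₗ) ⊎
              (Σ (V G) λ x → a₁ ~ x × aₚ ~ x × x ∉ a₀ ∷ a₁ ∷ ms ∷ʳ aₚ ∷ʳ aₗ) →
            CycleWithoutHangingP₂ (3 + k)
    cases (inj₁ (inj₁ a₀~aₚ)) =
      long (closing-edge⇒Cycle (a₁ ∷ ms) a₀⋯aₚ (~-sym a₀~aₚ))
        (≤-reflexive (sym (cong suc (length-ms∷ʳ aₚ))))
    cases (inj₁ (inj₂ (inj₁ a₀~aₗ))) = whole-path a₀~aₗ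
    cases (inj₁ (inj₂ (inj₂ (inj₁ a₁~aₚ)))) with a₀ ~? aₗ
    ... | yes a₀~aₗ = whole-path a₀~aₗ
    ... | no ¬a₀~aₗ = chorded a₁~aₚ ¬a₀~aₗ
    cases (inj₁ (inj₂ (inj₂ (inj₂ a₁~aₗ)))) =
      long (closing-edge⇒Cycle (ms ∷ʳ aₚ) (SimplePath-tail a₀⋯aₗ) (~-sym a₁~aₗ))
        (≤-reflexive (sym (length-ms∷ʳ∷ʳ aₚ aₗ)))
    cases (inj₂ (x , a₁~x , aₚ~x , x∉)) =
      long (closing-edge⇒Cycle (ms ∷ʳ aₚ)
             (∷ʳ-SimplePath {xs = a₁ ∷ ms} aₚ~x (x∉ ∘ there ∘ ∈-++⁺ˡ) (SimplePath-tail a₀⋯aₚ)) (~-sym a₁~x))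
        (≤-reflexive (sym (length-ms∷ʳ∷ʳ aₚ x)))

lemma4p1 : (G : Graph) → Connected G → YFree G →
    (ℓ : ℕ) (P : Fin (suc ℓ) → V G) → IsMinLongestPath G ℓ P → 5 ≤ ℓ →
    ((E G (P zero) (P (idxPen ℓ)) ⊎ E G (P zero) (P (fromℕ ℓ)) ⊎
      E G (P (idx1 ℓ)) (P (idxPen ℓ)) ⊎ E G (P (idx1 ℓ)) (P (fromℕ ℓ)))
     ⊎ (Σ (V G) λ x → E G (P (idx1 ℓ)) x × E G (P (idxPen ℓ)) x × ¬ (∃ λ i → P i ≡ x))) →
    Σ ℕ λ k → Σ (Fin (suc k) → V G) λ C →
      IsCycle G k C × EdgeDominating G k C × ℓ ∸ 1 ≤ suc k × 4 ≤ suc k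
lemma4p1 G conn yfree _ P (longest , _) (s≤s (s≤s (s≤s (s≤s (s≤s (z≤n {k})))))) hyp =
  at-least-4 (edge-dominating-cycle conn
    (long-path⇒CycleWithoutHangingP₂ yfree (length-tabulate (Q ∘ inject₁ ∘ inject₁))
      (IsLongestPath⇒MaxPathLength longest) path
      (Sum.map₂ (Product.map₂ (Product.map₂ (Product.map₂ ∉P⇒∉path))) hyp)))
  where
  open Paths G
  Q : Fin (4 + k) → V G
  Q i = P (suc (suc i))
  ms : List (V G)
  ms = tabulate (Q ∘ inject₁ ∘ inject₁)
  P-as-list : tabulate P ≡ P zero ∷ P (suc zero) ∷ ms ∷ʳ P (idxPen (5 + k)) ∷ʳ P (fromℕ (5 + k))
  P-as-list = cong (λ t → P zero ∷ P (suc zero) ∷ t)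
    (trans (tabulate-∷ʳ Q) (cong (_∷ʳ P (fromℕ (5 + k))) (tabulate-∷ʳ (Q ∘ inject₁))))
  path : SimplePath (P zero ∷ P (suc zero) ∷ ms ∷ʳ P (idxPen (5 + k)) ∷ʳ P (fromℕ (5 + k)))
  path = subst SimplePath P-as-list (IsPath⇒SimplePath (proj₁ longest))
  ∉P⇒∉path : ∀ {x} → ¬ (∃ λ i → P i ≡ x) →
    x ∉ P zero ∷ P (suc zero) ∷ ms ∷ʳ P (idxPen (5 + k)) ∷ʳ P (fromℕ (5 + k))
  ∉P⇒∉path {x} x∉P x∈ = x∉P (Product.map₂ sym (∈-tabulate⁻ (subst (x ∈_) (sym P-as-list) x∈)))
  at-least-4 :
    (Σ ℕ λ k′ → Σ (Fin (suc k′) → V G) λ C → IsCycle G k′ C × EdgeDominating G k′ C × 4 + k ≤ suc k′) →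
    Σ ℕ λ k′ → Σ (Fin (suc k′) → V G) λ C →
      IsCycle G k′ C × EdgeDominating G k′ C × 4 + k ≤ suc k′ × 4 ≤ suc k′
  at-least-4 (k′ , C , cycle , dominating , long) =
    k′ , C , cycle , dominating , long , ≤-trans (s≤s (s≤s (s≤s (s≤s z≤n)))) long
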